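{- Let $n,m\ge1$, let $S\subseteq[2n-1]$ with $|S|<2n-1$ and $S'\subseteq[2m-1]$ with $|S'|<2m-1$, and let $s,t\ge0$. If $C_1$ is an $(s,t)$-biregular component of $O_n(S)$ and $C_2$ is an $(s,t)$-biregular component of $O_m(S')$, then $C_1\cong C_2$.
   Context: $[2n-1]=\{1,\dots,2n-1\}$. The odd graph $O_n$ has as vertices the $(n-1)$-element subsets of $[2n-1]$, with $u\sim v$ iff $u\cap v=\emptyset$; the edge $uv$ receives the colour equal to the unique element of $[2n-1]\setminus(u\cup v)$. For $S\subseteq[2n-1]$, $O_n(S)$ is the spanning subgraph of $O_n$ obtained by deleting every edge whose colour lies in $S$. A component is a maximal connected subgraph. A graph is $(a,b)$-biregular if it is bipartite with a bipartition $V=U\cup W$ such that every vertex of $U$ has degree $a$ and every vertex of $W$ has degree $b$. -}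

module Defs where

open import Data.Nat using (ℕ; _*_; _∸_)
open import Data.Bool using (Bool; true; false; T; not; _∧_)
import Data.Bool.Properties as BoolP
open import Data.Fin using (Fin)
open import Data.Fin.Subset using (Subset; _∩_; _∪_; ∁; ⊥; ∣_∣)
open import Data.Vec.Properties using (≡-dec)
open import Data.Product using (Σ; _×_; ∃; proj₁; _,_)
open import Relation.Nullary using (¬_)
open import Relation.Nullary.Decidable using (⌊_⌋)
open import Relation.Binary.PropositionalEquality using (_≡_)
open import Function.Bundles using (_↔_; Inverse)

record Graph : Set₁ where
  field
    V : Set
    E : V → V → Bool
open Graph public

data Path (G : Graph) : V G → V G → Set where
  here  : ∀ {u} → Path G u u
  step  : ∀ {u v w} → T (E G u v) → Path G v w → Path G u w

Induced : (G : Graph) → (V G → Bool) → Graph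
Induced G C = record
  { V = Σ (V G) (λ v → T (C v))
  ; E = λ x y → E G (proj₁ x) (proj₁ y) }

-- C (with the induced edges) is a component, i.e. a maximal connected
-- subgraph: nonempty, connected, and no edge of G leaves C (maximality).
IsComponent : (G : Graph) → (V G → Bool) → Set
IsComponent G C =
  (∃ λ v → T (C v)) ×
  ((x y : V (Induced G C)) → Path (Induced G C) x y) ×
  ((u w : V G) → T (C u) → T (E G u w) → T (C w))

HasDegree : (G : Graph) → V G → ℕ → Set
HasDegree G v d = Fin d ↔ Σ (V G) (λ w → T (E G v w))

Biregular : ℕ → ℕ → Graph → Set
Biregular a b G = Σ (V G → Bool) λ side →
  ((u w : V G) → T (E G u w) → ¬ (side u ≡ side w)) ×
  ((u : V G) → side u ≡ true → HasDegree G u a) ×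
  ((u : V G) → side u ≡ false → HasDegree G u b)

_≅_ : Graph → Graph → Set
G ≅ H = Σ (V G ↔ V H) λ f →
  (u v : V G) → E G u v ≡ E H (Inverse.to f u) (Inverse.to f v)

ground : ℕ → ℕ
ground n = 2 * n ∸ 1

OddVertex : ℕ → Set
OddVertex n = Σ (Subset (ground n)) (λ u → ∣ u ∣ ≡ n ∸ 1)

private
  _≟ₛ_ : ∀ {k} (x y : Subset k) → _
  _≟ₛ_ = ≡-dec BoolP._≟_

-- u ~ v in O_n(S): u ≠ v, u ∩ v = ∅, and the colour of uv (the unique
-- element of [2n-1] ∖ (u ∪ v)) is not in S, i.e. ∁(u ∪ v) ∩ S = ∅.
oddAdj : (n : ℕ) → Subset (ground n) → OddVertex n → OddVertex n → Bool
oddAdj n S (u , _) (v , _) =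
  not ⌊ u ≟ₛ v ⌋ ∧ ⌊ (u ∩ v) ≟ₛ ⊥ ⌋ ∧ ⌊ (∁ (u ∪ v) ∩ S) ≟ₛ ⊥ ⌋

OddGraph : (n : ℕ) → Subset (ground n) → Graph
OddGraph n S = record { V = OddVertex n ; E = oddAdj n S }

module Submission where

-- Write a vertex u of O_{n'+1}(S) (an n'-subset of [2n'+1]) through its trace
-- on S and its trace off S, a subset of ∁ S, which has N points.  The colour of
-- an edge uv lies outside S, so on S the traces of u and v are complementary
-- and off S they are disjoint.  In a biregular component the trace on S is
-- hence A on one side and ∁ A on the other, the traces off S have constant
-- sizes k and k' with k + k' + 1 = N, and (side, trace off S) embeds the
-- component into the bipartite Kneser graph K(N; k, k') of k- and k'-subsets
-- of [N] under disjointness.  The embedding is onto because any two k-sets are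
-- joined by one-point exchanges, and an exchange X → Z is realised in the
-- component through the vertex with trace ∁ (X ∪ Z).  Counting neighbours in
-- K(N; k, k') gives s = k' + 1 and t = k + 1, so the component is
-- K(s + t - 1; t - 1, s - 1); if s or t is 0 it is a single vertex.

open import Defs
open import Data.Nat using (ℕ; zero; suc; _+_; _∸_; _≤_; _<_; z≤n; s≤s)
open import Data.Nat.Properties
  using ( suc-injective; +-suc; +-comm; +-identityʳ; +-cancelˡ-≡; ≡-irrelevant; m+n∸m≡n; m+n∸n≡m
        ; ≤-trans; ≤-reflexive; m≤n⇒m≤1+n; <-irrefl )
open import Data.Bool using (Bool; true; false; T; not; _∧_; _xor_; if_then_else_)
import Data.Bool.Properties as Boolₚ
open import Data.Bool.Properties using (T-∧; T-irrelevant; not-involutive; ¬-not)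
open import Data.Fin using (Fin; zero; suc)
open import Data.Fin.Permutation using (↔⇒≡)
open import Data.Fin.Subset using (Subset; ∣_∣; _∩_; _∪_; ∁; ⊥)
open import Data.Fin.Subset.Properties using (∪-comm; ∪-idem; ∣∁p∣≡n∸∣p∣)
open import Data.Vec using ([]; _∷_)
open import Data.Vec.Properties using (≡-dec)
open import Data.Product using (Σ; _×_; _,_; proj₁; proj₂)
open import Data.Empty using (⊥-elim)
open import Relation.Nullary using (does; yes; no; contradiction)
open import Relation.Nullary.Decidable using (dec-false; isYes≗does)
open import Relation.Binary.PropositionalEquality
open import Function.Base using (_∘_)
open import Function.Bundles using (_↔_; Inverse; mk↔ₛ′; Equivalence)
open import Function.Properties.Inverse using (↔-sym; ↔-trans)
open import Data.Nat.Tactic.RingSolver using (solve-∀)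

open Inverse using (to; from; strictlyInverseˡ; strictlyInverseʳ)

Nbhd : (G : Graph) → V G → Set
Nbhd G x = Σ (V G) (λ y → T (E G x y))

Σ-T-≡ : {A : Set} {P : A → Bool} {a a' : A} {p : T (P a)} {p' : T (P a')} →
        a ≡ a' → _≡_ {A = Σ A (λ z → T (P z))} (a , p) (a' , p')
Σ-T-≡ refl = cong (_ ,_) (T-irrelevant _ _)

≅-sym : {G H : Graph} → G ≅ H → H ≅ G
≅-sym {G} {H} (f , pres) = ↔-sym f , λ u v → sym (begin
    E G (from f u) (from f v)
  ≡⟨ pres (from f u) (from f v) ⟩
    E H (to f (from f u)) (to f (from f v))
  ≡⟨ cong₂ (E H) (strictlyInverseˡ f u) (strictlyInverseˡ f v) ⟩
    E H u v ∎)
  where open ≡-Reasoning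

≅-trans : {G H K : Graph} → G ≅ H → H ≅ K → G ≅ K
≅-trans (f , p) (g , q) = ↔-trans f g , λ u v → trans (p u v) (q (to f u) (to f v))

≅-nbhd : {G H : Graph} (φ : G ≅ H) (x : V G) → Nbhd G x ↔ Nbhd H (to (proj₁ φ) x)
≅-nbhd {G} {H} (f , pres) x = mk↔ₛ′ forth back
  (λ { (y , e) → Σ-T-≡ {P = E H (to f x)} (strictlyInverseˡ f y) })
  (λ { (y , e) → Σ-T-≡ {P = E G x} (strictlyInverseʳ f y) })
  where
  forth : Nbhd G x → Nbhd H (to f x)
  forth (y , e) = to f y , subst T (pres x y) e
  back : Nbhd H (to f x) → Nbhd G x
  back (y , e) = from f y ,
    subst T (sym (trans (pres x (from f y)) (cong (E H (to f x)) (strictlyInverseˡ f y)))) e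

walk-invariant : {G : Graph} (P : V G → Set) →
                 (∀ {x y} → T (E G x y) → P x → P y) →
                 ∀ {x y} → Path G x y → P x → P y
walk-invariant P keep here px = px
walk-invariant P keep (step e p) px = walk-invariant P keep p (keep e px)

opposite-sides : {a b : ℕ} {G : Graph} (bir : Biregular a b G) {x y : V G} →
                 T (E G x y) → proj₁ bir y ≡ not (proj₁ bir x)
opposite-sides (side , bip , _) {x} {y} e = ¬-not (λ eq → bip x y e (sym eq))

same-side-no-edge : {a b : ℕ} {G : Graph} (bir : Biregular a b G) {x y : V G} →
                    proj₁ bir x ≡ proj₁ bir y → E G x y ≡ false
same-side-no-edge {G = G} (side , bip , _) {x} {y} eq with E G x y in exy
... | false = refl
... | true = contradiction eq (bip x y (subst T (sym exy) _))

biregular-swap : {a b : ℕ} {G : Graph} → Biregular a b G → Biregular b a G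
biregular-swap (side , bip , degT , degF) =
  (λ x → not (side x)) ,
  (λ x y e eq → bip x y e (Boolₚ.not-injective eq)) ,
  (λ x e → degF x (Boolₚ.not-injective e)) ,
  (λ x e → degT x (Boolₚ.not-injective e))

isolated-walk : {G : Graph} {x y : V G} → HasDegree G x 0 → Path G x y → x ≡ y
isolated-walk deg here = refl
isolated-walk deg (step e _) with from deg (_ , e)
... | ()

-- If the vertices of one side have degree 0 and any two vertices are
-- joined by a walk, then the graph has at most one vertex: walks cannot
-- leave a vertex of degree 0, and cannot pass through one either.
biregular-zero-trivial : {b : ℕ} {G : Graph} → Biregular 0 b G →
                         ((x y : V G) → Path G x y) → (x y : V G) → x ≡ y
biregular-zero-trivial {G = G} bir@(side , _ , degT , _) walk x y
  with side x in sx | side y in sy | walk x y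
... | true  | _     | p = isolated-walk (degT x sx) p
... | false | true  | _ = sym (isolated-walk (degT y sy) (walk y x))
... | false | false | here = refl
... | false | false | step {v = v} e p = contradiction (trans (sym sy) sv′) λ ()
  where
  sv : side v ≡ true
  sv = trans (opposite-sides bir e) (cong not sx)
  sv′ : side y ≡ true
  sv′ = subst (λ w → side w ≡ true) (isolated-walk (degT v sv) p) sv

single-vertex-≅ : {G H : Graph} (a : V G) (b : V H) → (∀ x → x ≡ a) → (∀ y → y ≡ b) →
                  E G a a ≡ false → E H b b ≡ false → G ≅ H
single-vertex-≅ {G} {H} a b onlyA onlyB la lb =
  mk↔ₛ′ (λ _ → b) (λ _ → a) (λ y → sym (onlyB y)) (λ x → sym (onlyA x)) ,
  λ u v → trans (cong₂ (E G) (onlyA u) (onlyA v)) (trans la (sym lb))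

trivial-components-≅ : {b b' : ℕ} {G H : Graph} {C : V G → Bool} {D : V H → Bool} →
  IsComponent G C → IsComponent H D →
  Biregular 0 b (Induced G C) → Biregular 0 b' (Induced H D) → Induced G C ≅ Induced H D
trivial-components-≅ {G = G} {H} {C} {D} ((a , ca) , walkG , _) ((b , db) , walkH , _) birG birH =
  single-vertex-≅ {Induced G C} {Induced H D} (a , ca) (b , db)
    (λ x → biregular-zero-trivial birG walkG x (a , ca))
    (λ y → biregular-zero-trivial birH walkH y (b , db))
    (same-side-no-edge birG {a , ca} refl) (same-side-no-edge birH {b , db} refl)

-- Subsets of [L] as bit vectors

-- Boolean equality and emptiness tests; `does` (rather than `⌊_⌋`) computes
-- coordinatewise on vectors with known heads.
same? : ∀ {L} → Subset L → Subset L → Bool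
same? u v = does (≡-dec Boolₚ._≟_ u v)

empty? : ∀ {L} → Subset L → Bool
empty? p = same? p ⊥

∁-involutive : ∀ {L} (p : Subset L) → ∁ (∁ p) ≡ p
∁-involutive [] = refl
∁-involutive (x ∷ p) = cong₂ _∷_ (not-involutive x) (∁-involutive p)

∣p∣+∣∁p∣ : ∀ {L} (p : Subset L) → ∣ p ∣ + ∣ ∁ p ∣ ≡ L
∣p∣+∣∁p∣ [] = refl
∣p∣+∣∁p∣ (true ∷ p) = cong suc (∣p∣+∣∁p∣ p)
∣p∣+∣∁p∣ (false ∷ p) = trans (+-suc _ _) (cong suc (∣p∣+∣∁p∣ p))

self-disjoint : ∀ {L} (p : Subset L) → T (empty? (p ∩ p)) → ∣ p ∣ ≡ 0
self-disjoint [] _ = refl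
self-disjoint (false ∷ p) e = self-disjoint p e

size-zero : ∀ {L} (p : Subset L) → ∣ p ∣ ≡ 0 → p ≡ ⊥
size-zero [] _ = refl
size-zero (false ∷ p) e = cong (false ∷_) (size-zero p e)

disjoint-∁ : ∀ {L} (p : Subset L) → T (empty? (p ∩ ∁ p))
disjoint-∁ [] = _
disjoint-∁ (true ∷ p) = disjoint-∁ p
disjoint-∁ (false ∷ p) = disjoint-∁ p

disjoint-∁-∪ˡ : ∀ {L} (p q : Subset L) → T (empty? (p ∩ ∁ (p ∪ q)))
disjoint-∁-∪ˡ [] [] = _
disjoint-∁-∪ˡ (true ∷ p) (y ∷ q) = disjoint-∁-∪ˡ p q
disjoint-∁-∪ˡ (false ∷ p) (y ∷ q) = disjoint-∁-∪ˡ p q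

disjoint-∁-∪ʳ : ∀ {L} (p q : Subset L) → T (empty? (∁ (p ∪ q) ∩ q))
disjoint-∁-∪ʳ [] [] = _
disjoint-∁-∪ʳ (true ∷ p) (y ∷ q) = disjoint-∁-∪ʳ p q
disjoint-∁-∪ʳ (false ∷ p) (true ∷ q) = disjoint-∁-∪ʳ p q
disjoint-∁-∪ʳ (false ∷ p) (false ∷ q) = disjoint-∁-∪ʳ p q

restrict : ∀ {L} (S : Subset L) → Subset L → Subset ∣ S ∣
restrict [] [] = []
restrict (true ∷ S) (x ∷ u) = x ∷ restrict S u
restrict (false ∷ S) (x ∷ u) = restrict S u

restrict∁ : ∀ {L} (S : Subset L) → Subset L → Subset ∣ ∁ S ∣
restrict∁ [] [] = []
restrict∁ (true ∷ S) (x ∷ u) = restrict∁ S u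
restrict∁ (false ∷ S) (x ∷ u) = x ∷ restrict∁ S u

glue : ∀ {L} (S : Subset L) → Subset ∣ S ∣ → Subset ∣ ∁ S ∣ → Subset L
glue [] [] [] = []
glue (true ∷ S) (x ∷ a) y = x ∷ glue S a y
glue (false ∷ S) a (x ∷ y) = x ∷ glue S a y

restrict-glue : ∀ {L} (S : Subset L) a y → restrict S (glue S a y) ≡ a
restrict-glue [] [] [] = refl
restrict-glue (true ∷ S) (x ∷ a) y = cong (x ∷_) (restrict-glue S a y)
restrict-glue (false ∷ S) a (x ∷ y) = restrict-glue S a y

restrict∁-glue : ∀ {L} (S : Subset L) a y → restrict∁ S (glue S a y) ≡ y
restrict∁-glue [] [] [] = refl
restrict∁-glue (true ∷ S) (x ∷ a) y = restrict∁-glue S a y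
restrict∁-glue (false ∷ S) a (x ∷ y) = cong (x ∷_) (restrict∁-glue S a y)

glue-restrict : ∀ {L} (S u : Subset L) → glue S (restrict S u) (restrict∁ S u) ≡ u
glue-restrict [] [] = refl
glue-restrict (true ∷ S) (x ∷ u) = cong (x ∷_) (glue-restrict S u)
glue-restrict (false ∷ S) (x ∷ u) = cong (x ∷_) (glue-restrict S u)

∣glue∣ : ∀ {L} (S : Subset L) a y → ∣ glue S a y ∣ ≡ ∣ a ∣ + ∣ y ∣
∣glue∣ [] [] [] = refl
∣glue∣ (true ∷ S) (true ∷ a) y = cong suc (∣glue∣ S a y)
∣glue∣ (true ∷ S) (false ∷ a) y = ∣glue∣ S a y
∣glue∣ (false ∷ S) a (true ∷ y) = trans (cong suc (∣glue∣ S a y)) (sym (+-suc _ _))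
∣glue∣ (false ∷ S) a (false ∷ y) = ∣glue∣ S a y

∣restrict∣ : ∀ {L} (S u : Subset L) → ∣ restrict S u ∣ + ∣ restrict∁ S u ∣ ≡ ∣ u ∣
∣restrict∣ S u = trans (sym (∣glue∣ S (restrict S u) (restrict∁ S u))) (cong ∣_∣ (glue-restrict S u))

-- Adjacency in O_n(S) in coordinates relative to S

-- u and v are disjoint and leave no point of S uncovered.  For vertices of
-- O_n the complement of u ∪ v is the colour of the edge uv, so this says
-- that the colour lies outside S.
compatible : ∀ {L} → Subset L → Subset L → Subset L → Bool
compatible S u v = empty? (u ∩ v) ∧ empty? (∁ (u ∪ v) ∩ S)

oddAdj-compatible : ∀ n S (x y : OddVertex n) →
  oddAdj n S x y ≡ not (same? (proj₁ x) (proj₁ y)) ∧ compatible S (proj₁ x) (proj₁ y)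
oddAdj-compatible n S (u , _) (v , _)
  rewrite isYes≗does (≡-dec Boolₚ._≟_ u v)
        | isYes≗does (≡-dec Boolₚ._≟_ (u ∩ v) ⊥)
        | isYes≗does (≡-dec Boolₚ._≟_ (∁ (u ∪ v) ∩ S) ⊥) = refl

compatible⇒complementary : ∀ {L} (S u v : Subset L) →
  T (compatible S u v) → restrict S v ≡ ∁ (restrict S u)
compatible⇒complementary [] [] [] _ = refl
compatible⇒complementary (true ∷ S) (true ∷ u) (false ∷ v) c =
  cong (false ∷_) (compatible⇒complementary S u v c)
compatible⇒complementary (true ∷ S) (false ∷ u) (true ∷ v) c =
  cong (true ∷_) (compatible⇒complementary S u v c)
compatible⇒complementary (true ∷ S) (false ∷ u) (false ∷ v) c =
  ⊥-elim (proj₂ (Equivalence.to T-∧ c))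
compatible⇒complementary (false ∷ S) (true ∷ u) (false ∷ v) c = compatible⇒complementary S u v c
compatible⇒complementary (false ∷ S) (false ∷ u) (true ∷ v) c = compatible⇒complementary S u v c
compatible⇒complementary (false ∷ S) (false ∷ u) (false ∷ v) c = compatible⇒complementary S u v c

compatible-glue : ∀ {L} (S u : Subset L) y →
  compatible S u (glue S (∁ (restrict S u)) y) ≡ empty? (restrict∁ S u ∩ y)
compatible-glue [] [] [] = refl
compatible-glue (true ∷ S) (true ∷ u) y = compatible-glue S u y
compatible-glue (true ∷ S) (false ∷ u) y = compatible-glue S u y
compatible-glue (false ∷ S) (true ∷ u) (true ∷ y) = refl
compatible-glue (false ∷ S) (true ∷ u) (false ∷ y) = compatible-glue S u y
compatible-glue (false ∷ S) (false ∷ u) (true ∷ y) = compatible-glue S u y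
compatible-glue (false ∷ S) (false ∷ u) (false ∷ y) = compatible-glue S u y

compatible-off-S : ∀ {L} (S u v : Subset L) → restrict S v ≡ ∁ (restrict S u) →
  compatible S u v ≡ empty? (restrict∁ S u ∩ restrict∁ S v)
compatible-off-S S u v complementary = begin
    compatible S u v
  ≡⟨ cong (compatible S u) (sym (glue-restrict S v)) ⟩
    compatible S u (glue S (restrict S v) (restrict∁ S v))
  ≡⟨ cong (λ a → compatible S u (glue S a (restrict∁ S v))) complementary ⟩
    compatible S u (glue S (∁ (restrict S u)) (restrict∁ S v))
  ≡⟨ compatible-glue S u (restrict∁ S v) ⟩
    empty? (restrict∁ S u ∩ restrict∁ S v) ∎
  where open ≡-Reasoning

edge⇒complementary : ∀ n S (x y : OddVertex n) → T (oddAdj n S x y) →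
  restrict S (proj₁ y) ≡ ∁ (restrict S (proj₁ x))
edge⇒complementary n S x y e =
  compatible⇒complementary S (proj₁ x) (proj₁ y)
    (proj₂ (Equivalence.to (T-∧ {not (same? (proj₁ x) (proj₁ y))})
      (subst T (oddAdj-compatible n S x y) e)))

adjacency-off-S : ∀ n S (x y : OddVertex n) → proj₁ x ≢ proj₁ y →
  restrict S (proj₁ y) ≡ ∁ (restrict S (proj₁ x)) →
  oddAdj n S x y ≡ empty? (restrict∁ S (proj₁ x) ∩ restrict∁ S (proj₁ y))
adjacency-off-S n S x@(u , _) y@(v , _) u≢v complementary = begin
    oddAdj n S x y
  ≡⟨ oddAdj-compatible n S x y ⟩
    not (same? u v) ∧ compatible S u v
  ≡⟨ cong (λ b → not b ∧ compatible S u v) (dec-false (≡-dec Boolₚ._≟_ u v) u≢v) ⟩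
    compatible S u v
  ≡⟨ compatible-off-S S u v complementary ⟩
    empty? (restrict∁ S u ∩ restrict∁ S v) ∎
  where open ≡-Reasoning

-- For nonempty vertices, disjointness already excludes u = v.
adjacent-off-S : ∀ n S (x y : OddVertex n) → ∣ proj₁ x ∣ ≢ 0 →
  restrict S (proj₁ y) ≡ ∁ (restrict S (proj₁ x)) →
  T (empty? (restrict∁ S (proj₁ x) ∩ restrict∁ S (proj₁ y))) → T (oddAdj n S x y)
adjacent-off-S n S x@(u , _) y@(v , _) nonempty complementary disjoint =
  subst T (sym (adjacency-off-S n S x y distinct complementary)) disjoint
  where
  distinct : u ≢ v
  distinct refl = nonempty (self-disjoint u (proj₁ (Equivalence.to T-∧
    (subst T (sym (compatible-off-S S u u complementary)) disjoint))))

-- Counting the j-sets disjoint from a given set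

DisjointOfSize : ∀ {N} → Subset N → ℕ → Set
DisjointOfSize {N} X j = Σ (Subset N) λ Y → ∣ Y ∣ ≡ j × T (empty? (X ∩ Y))

DisjointOfSize-≡ : ∀ {N} {X : Subset N} {j} {Y Y' : Subset N} {p p' d d'} → Y ≡ Y' →
                   _≡_ {A = DisjointOfSize X j} (Y , p , d) (Y' , p' , d')
DisjointOfSize-≡ refl = cong₂ (λ p d → (_ , p , d)) (≡-irrelevant _ _) (T-irrelevant _ _)

disjoint-size-bound : ∀ {N} (X Y : Subset N) → T (empty? (X ∩ Y)) → ∣ X ∣ + ∣ Y ∣ ≤ N
disjoint-size-bound [] [] _ = z≤n
disjoint-size-bound (true ∷ X) (false ∷ Y) d = s≤s (disjoint-size-bound X Y d)
disjoint-size-bound (false ∷ X) (true ∷ Y) d =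
  ≤-trans (≤-reflexive (+-suc ∣ X ∣ ∣ Y ∣)) (s≤s (disjoint-size-bound X Y d))
disjoint-size-bound (false ∷ X) (false ∷ Y) d = m≤n⇒m≤1+n (disjoint-size-bound X Y d)

complement-unique : ∀ {N} (X Y : Subset N) → T (empty? (X ∩ Y)) → ∣ X ∣ + ∣ Y ∣ ≡ N → Y ≡ ∁ X
complement-unique [] [] _ _ = refl
complement-unique (true ∷ X) (false ∷ Y) d e = cong (false ∷_) (complement-unique X Y d (suc-injective e))
complement-unique (false ∷ X) (true ∷ Y) d e =
  cong (true ∷_) (complement-unique X Y d (suc-injective (trans (sym (+-suc ∣ X ∣ ∣ Y ∣)) e)))
complement-unique (false ∷ X) (false ∷ Y) d e =
  contradiction (≤-trans (≤-reflexive (sym e)) (disjoint-size-bound X Y d)) (<-irrefl refl)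

+-suc-injective : ∀ {m j N} → m + suc j ≡ suc N → m + j ≡ N
+-suc-injective {m} e = suc-injective (trans (sym (+-suc m _)) e)

complementPoint : ∀ {N j} (X : Subset N) → ∣ X ∣ + j ≡ N → DisjointOfSize (false ∷ X) j
complementPoint X e = false ∷ ∁ X , +-cancelˡ-≡ ∣ X ∣ _ _ (trans (∣p∣+∣∁p∣ X) (sym e)) , disjoint-∁ X

complementPoint-unique : ∀ {N j} (X : Subset N) (e : ∣ X ∣ + j ≡ N) Y p d →
                         complementPoint X e ≡ (false ∷ Y , p , d)
complementPoint-unique X e Y p d = DisjointOfSize-≡ {X = false ∷ X}
  (cong (false ∷_) (sym (complement-unique X Y d (trans (cong (∣ X ∣ +_) p) e))))

-- If |X| + j + 1 = N, the j-sets disjoint from X are the complements in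
-- ∁ X (a (j+1)-set) of its single points, so there are j + 1 of them.
count-disjoint : ∀ {N j} (X : Subset N) → ∣ X ∣ + suc j ≡ N → DisjointOfSize X j ↔ Fin (suc j)
count-disjoint {j = j} (true ∷ X) e = ↔-trans dropHead (count-disjoint X (suc-injective e))
  where
  dropHead : DisjointOfSize (true ∷ X) j ↔ DisjointOfSize X j
  dropHead = mk↔ₛ′ (λ { (false ∷ Y , p , d) → Y , p , d })
                   (λ { (Y , p , d) → false ∷ Y , p , d })
                   (λ _ → refl) (λ { (false ∷ Y , p , d) → refl })
count-disjoint {suc N} {zero} (false ∷ X) e =
  mk↔ₛ′ (λ _ → zero) (λ _ → complementPoint X (+-suc-injective e)) (λ { zero → refl })
        (λ { (false ∷ Y , p , d) → complementPoint-unique X (+-suc-injective e) Y p d })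
count-disjoint {suc N} {suc j} (false ∷ X) e = mk↔ₛ′ forth back forth-back back-forth
  where
  e′ : ∣ X ∣ + suc j ≡ N
  e′ = +-suc-injective e
  rest : DisjointOfSize X j ↔ Fin (suc j)
  rest = count-disjoint X e′
  forth : DisjointOfSize (false ∷ X) (suc j) → Fin (suc (suc j))
  forth (false ∷ Y , p , d) = zero
  forth (true ∷ Y , p , d) = suc (to rest (Y , suc-injective p , d))
  back : Fin (suc (suc j)) → DisjointOfSize (false ∷ X) (suc j)
  back zero = complementPoint X e′
  back (suc i) with from rest i
  ... | Y , p , d = true ∷ Y , cong suc p , d
  forth-back : ∀ i → forth (back i) ≡ i
  forth-back zero = refl
  forth-back (suc i) =
    cong suc (trans (cong (to rest) (DisjointOfSize-≡ {X = X} refl)) (strictlyInverseˡ rest i))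
  back-forth : ∀ Y → back (forth Y) ≡ Y
  back-forth (false ∷ Y , p , d) = complementPoint-unique X e′ Y p d
  back-forth (true ∷ Y , p , d) =
    trans (cong (λ { (Y′ , p′ , d′) → (true ∷ Y′ , cong suc p′ , d′) })
                (strictlyInverseʳ rest (Y , suc-injective p , d)))
          (DisjointOfSize-≡ {X = false ∷ X} refl)

-- The bipartite Kneser graph

level : ℕ → ℕ → Bool → ℕ
level j j' b = if b then j else j'

KneserVertex : ℕ → ℕ → ℕ → Set
KneserVertex N j j' = Σ Bool λ b → Σ (Subset N) λ X → ∣ X ∣ ≡ level j j' b

kneserAdj : ∀ {N j j'} → KneserVertex N j j' → KneserVertex N j j' → Bool
kneserAdj (b , X , _) (b' , Y , _) = (b xor b') ∧ empty? (X ∩ Y)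

Kneser : ℕ → ℕ → ℕ → Graph
Kneser N j j' = record { V = KneserVertex N j j' ; E = kneserAdj }

KneserVertex-≡ : ∀ {N j j' b b'} {X X' : Subset N} {p p'} → b ≡ b' → X ≡ X' →
                 _≡_ {A = KneserVertex N j j'} (b , X , p) (b' , X' , p')
KneserVertex-≡ {b = b} {X = X} refl refl = cong (λ p → (b , X , p)) (≡-irrelevant _ _)

kneser-nbhd : ∀ {N j j'} (b : Bool) (X : Subset N) (p : ∣ X ∣ ≡ level j j' b) →
  Nbhd (Kneser N j j') (b , X , p) ↔ DisjointOfSize X (level j j' (not b))
kneser-nbhd true X p = mk↔ₛ′
  (λ { ((false , Y , q) , d) → Y , q , d })
  (λ { (Y , q , d) → (false , Y , q) , d })
  (λ _ → refl) (λ { ((false , Y , q) , d) → refl })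
kneser-nbhd false X p = mk↔ₛ′
  (λ { ((true , Y , q) , d) → Y , q , d })
  (λ { (Y , q , d) → (true , Y , q) , d })
  (λ _ → refl) (λ { ((true , Y , q) , d) → refl })

kneser-degree : ∀ {N j j'} → suc (j + j') ≡ N → (v : KneserVertex N j j') →
  Nbhd (Kneser N j j') v ↔ Fin (suc (level j j' (not (proj₁ v))))
kneser-degree {j = j} {j'} e (b , X , p) =
  ↔-trans (kneser-nbhd b X p) (count-disjoint X (trans (cong (_+ _) p) (trans (levels b) e)))
  where
  levels : ∀ b → level j j' b + suc (level j j' (not b)) ≡ suc (j + j')
  levels true = +-suc j j'
  levels false = trans (+-suc j' j) (cong suc (+-comm j' j))

-- Exchange chains: connectivity of one level of the Kneser graph

-- A chain of j-sets from X to W in which consecutive sets Z, Z' satisfy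
-- |Z ∪ Z'| = j + 1, i.e. Z' arises from Z by exchanging one point.
data Chain {N : ℕ} (j : ℕ) : Subset N → Subset N → Set where
  stay     : ∀ {X} → Chain j X X
  exchange : ∀ {X Z W} → ∣ Z ∣ ≡ j → ∣ X ∪ Z ∣ ≡ suc j → Chain j Z W → Chain j X W

_▸_ : ∀ {N j} {X Z W : Subset N} → Chain j X Z → Chain j Z W → Chain j X W
stay ▸ d = d
exchange p q c ▸ d = exchange p q (c ▸ d)

chain-∷ : ∀ {N j} {X W : Subset N} (a : Bool) →
          Chain j X W → Chain (if a then suc j else j) (a ∷ X) (a ∷ W)
chain-∷ a stay = stay
chain-∷ true (exchange p q c) = exchange (cong suc p) (cong suc q) (chain-∷ true c)
chain-∷ false (exchange p q c) = exchange p q (chain-∷ false c)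

drop-point : ∀ {N j} (X : Subset N) → ∣ X ∣ ≡ suc j →
             Σ (Subset N) λ X′ → X′ ∪ X ≡ X × ∣ X′ ∣ ≡ j
drop-point (true ∷ X) e = false ∷ X , cong (true ∷_) (∪-idem X) , suc-injective e
drop-point (false ∷ X) e with drop-point X e
... | X′ , sub , size = false ∷ X′ , cong (false ∷_) sub , size

-- Where the first
-- coordinates differ, the set containing the first point is first moved
-- (by recursion) onto a subset of the other one and then exchanged with it.
connect : ∀ {N j} (X W : Subset N) → ∣ X ∣ ≡ j → ∣ W ∣ ≡ j → Chain j X W
connect [] [] _ _ = stay
connect (true ∷ X) (true ∷ W) refl q = chain-∷ true (connect X W refl (suc-injective q))
connect (false ∷ X) (false ∷ W) p q = chain-∷ false (connect X W p q)
connect (true ∷ X) (false ∷ W) refl q with drop-point W q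
... | W′ , sub , size =
  chain-∷ true (connect X W′ refl size) ▸ exchange q (cong suc (trans (cong ∣_∣ sub) q)) stay
connect (false ∷ X) (true ∷ W) p refl with drop-point X p
... | X′ , sub , size =
  exchange (cong suc size) (cong suc (trans (cong ∣_∣ (trans (∪-comm X X′) sub)) p))
           (chain-∷ true (connect X′ W size refl))

xor-cases : (a b : Bool) {e d : Bool} → (a ≡ b → e ≡ false) → (b ≡ not a → e ≡ d) →
            e ≡ (a xor b) ∧ d
xor-cases true true same _ = same refl
xor-cases false false same _ = same refl
xor-cases true false _ other = other refl
xor-cases false true _ other = other refl

ground-suc : ∀ n' → ground (suc n') ≡ suc (n' + n')
ground-suc n' = trans (+-suc n' (n' + 0)) (cong (λ m → suc (n' + m)) (+-identityʳ n'))

≅-Kneser-cong : ∀ {G N N' j j' i i'} → N ≡ N' → j ≡ i → j' ≡ i' →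
                G ≅ Kneser N j j' → G ≅ Kneser N' i i'
≅-Kneser-cong refl refl refl φ = φ

-- Biregular components of O_n(S) with positive degrees

-- Along an edge
-- the trace on S is complemented and the side changes, so the trace on S
-- is A on one side and ∁ A on the other.  The traces off S therefore
-- determine the vertices of each side; they have constant sizes k and k'
-- with k + k' + 1 = N = |∁ S|, adjacency among them is disjointness, and
-- exchange chains lift to the component.  So the component is K(N; k, k'),
-- whose degrees give k' = s' and k = t'.
module BiregularComponent
  (n' : ℕ) (S : Subset (ground (suc n'))) (C : V (OddGraph (suc n') S) → Bool)
  (component : IsComponent (OddGraph (suc n') S) C)
  {s' t' : ℕ} (bir : Biregular (suc s') (suc t') (Induced (OddGraph (suc n') S) C))
  where

  G : Graph
  G = OddGraph (suc n') S

  GC : Graph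
  GC = Induced G C

  N : ℕ
  N = ∣ ∁ S ∣

  side : V GC → Bool
  side = proj₁ bir

  degree-true : (x : V GC) → side x ≡ true → HasDegree GC x (suc s')
  degree-true = proj₁ (proj₂ (proj₂ bir))

  degree-false : (x : V GC) → side x ≡ false → HasDegree GC x (suc t')
  degree-false = proj₂ (proj₂ (proj₂ bir))

  vec : V GC → Subset (ground (suc n'))
  vec x = proj₁ (proj₁ x)

  onS : V GC → Subset ∣ S ∣
  onS x = restrict S (vec x)

  offS : V GC → Subset N
  offS x = restrict∁ S (vec x)

  size : (x : V GC) → ∣ vec x ∣ ≡ n'
  size x = proj₂ (proj₁ x)

  vertex-≡ : {x y : V GC} → vec x ≡ vec y → x ≡ y
  vertex-≡ {(u , p) , c} {(.u , p') , c'} refl =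
    Σ-T-≡ {P = C} (cong (u ,_) (≡-irrelevant p p'))

  -- Every vertex has a neighbour, because all degrees are positive.
  neighbour : (x : V GC) → Nbhd GC x
  neighbour x with side x in sx
  ... | true = to (degree-true x sx) zero
  ... | false = to (degree-false x sx) zero

  reference : (b : Bool) → Σ (V GC) λ x → side x ≡ b
  reference b with side (proj₁ component) Boolₚ.≟ b
  ... | yes e = proj₁ component , e
  ... | no ne = proj₁ (neighbour (proj₁ component)) ,
                trans (opposite-sides bir (proj₂ (neighbour (proj₁ component))))
                      (sym (¬-not (λ e → ne (sym e))))

  A : Subset ∣ S ∣
  A = onS (proj₁ (reference true))

  part : Bool → Subset ∣ S ∣
  part b = if b then A else ∁ A

  ∁-part : ∀ b → ∁ (part b) ≡ part (not b)
  ∁-part true = refl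
  ∁-part false = ∁-involutive A

  onS-by-side : (x : V GC) → onS x ≡ part (side x)
  onS-by-side x = walk-invariant (λ y → onS y ≡ part (side y)) preserved
    (proj₁ (proj₂ component) r x) (cong part (sym (proj₂ (reference true))))
    where
    r : V GC
    r = proj₁ (reference true)
    preserved : ∀ {y z} → T (E GC y z) → onS y ≡ part (side y) → onS z ≡ part (side z)
    preserved {y} {z} e hy = begin
        onS z                ≡⟨ edge⇒complementary (suc n') S (proj₁ y) (proj₁ z) e ⟩
        ∁ (onS y)            ≡⟨ cong ∁ hy ⟩
        ∁ (part (side y))    ≡⟨ ∁-part (side y) ⟩
        part (not (side y))  ≡⟨ cong part (sym (opposite-sides bir e)) ⟩
        part (side z)        ∎
      where open ≡-Reasoning

  opposite-complementary : (x y : V GC) → side y ≡ not (side x) → onS y ≡ ∁ (onS x)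
  opposite-complementary x y sy = begin
      onS y               ≡⟨ onS-by-side y ⟩
      part (side y)       ≡⟨ cong part sy ⟩
      part (not (side x)) ≡⟨ sym (∁-part (side x)) ⟩
      ∁ (part (side x))   ≡⟨ cong ∁ (sym (onS-by-side x)) ⟩
      ∁ (onS x)           ∎
    where open ≡-Reasoning

  determined : {x y : V GC} → side x ≡ side y → offS x ≡ offS y → x ≡ y
  determined {x} {y} sxy oxy = vertex-≡ (begin
      vec x                           ≡⟨ sym (glue-restrict S (vec x)) ⟩
      glue S (onS x) (offS x)         ≡⟨ cong₂ (glue S) (trans (onS-by-side x) (cong part sxy)) oxy ⟩
      glue S (part (side y)) (offS y) ≡⟨ cong₂ (glue S) (sym (onS-by-side y)) refl ⟩
      glue S (onS y) (offS y)         ≡⟨ glue-restrict S (vec y) ⟩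
      vec y                           ∎)
    where open ≡-Reasoning

  k k' : ℕ
  k = ∣ offS (proj₁ (reference true)) ∣
  k' = ∣ offS (proj₁ (reference false)) ∣

  ℓ : Bool → ℕ
  ℓ = level k k'

  reference-level : ∀ b → ∣ offS (proj₁ (reference b)) ∣ ≡ ℓ b
  reference-level true = refl
  reference-level false = refl

  part-size : ∀ b → ∣ part b ∣ + ℓ b ≡ n'
  part-size b = begin
      ∣ part b ∣ + ℓ b      ≡⟨ cong₂ (λ a m → ∣ a ∣ + m) part-r (sym (reference-level b)) ⟩
      ∣ onS r ∣ + ∣ offS r ∣ ≡⟨ ∣restrict∣ S (vec r) ⟩
      ∣ vec r ∣              ≡⟨ size r ⟩
      n'                    ∎
    where
    open ≡-Reasoning
    r : V GC
    r = proj₁ (reference b)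
    part-r : part b ≡ onS r
    part-r = trans (cong part (sym (proj₂ (reference b)))) (sym (onS-by-side r))

  offS-size : (x : V GC) → ∣ offS x ∣ ≡ ℓ (side x)
  offS-size x = +-cancelˡ-≡ ∣ part (side x) ∣ _ _ (begin
      ∣ part (side x) ∣ + ∣ offS x ∣ ≡⟨ cong (λ a → ∣ a ∣ + ∣ offS x ∣) (sym (onS-by-side x)) ⟩
      ∣ onS x ∣ + ∣ offS x ∣         ≡⟨ ∣restrict∣ S (vec x) ⟩
      ∣ vec x ∣                     ≡⟨ size x ⟩
      n'                            ≡⟨ sym (part-size (side x)) ⟩
      ∣ part (side x) ∣ + ℓ (side x) ∎)
    where open ≡-Reasoning

  -- Counting points: |S| + N = 2n' + 1 = (|A| + k) + (|∁ A| + k') + 1.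
  levels-sum : suc (k + k') ≡ N
  levels-sum = +-cancelˡ-≡ ∣ S ∣ _ _ (begin
      ∣ S ∣ + suc (k + k')                         ≡⟨ cong (_+ suc (k + k')) (sym (∣p∣+∣∁p∣ A)) ⟩
      (∣ A ∣ + ∣ ∁ A ∣) + suc (k + k')             ≡⟨ regroup ∣ A ∣ ∣ ∁ A ∣ k k' ⟩
      suc ((∣ A ∣ + k) + (∣ ∁ A ∣ + k'))
        ≡⟨ cong suc (cong₂ _+_ (part-size true) (part-size false)) ⟩
      suc (n' + n')                                ≡⟨ sym (ground-suc n') ⟩
      ground (suc n')                              ≡⟨ sym (∣p∣+∣∁p∣ S) ⟩
      ∣ S ∣ + N                                    ∎)
    where
    open ≡-Reasoning
    regroup : ∀ a b c d → (a + b) + suc (c + d) ≡ suc ((a + c) + (b + d))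
    regroup = solve-∀

  toKneser : V GC → KneserVertex N k k'
  toKneser x = side x , offS x , offS-size x

  toKneser-edges : (x y : V GC) → E GC x y ≡ kneserAdj (toKneser x) (toKneser y)
  toKneser-edges x y = xor-cases (side x) (side y) (same-side-no-edge bir)
    λ sy → adjacency-off-S (suc n') S (proj₁ x) (proj₁ y)
             (λ eq → contradiction (trans (cong side (vertex-≡ eq)) sy) (Boolₚ.not-¬ refl))
             (opposite-complementary x y sy)

  -- Vertices are nonempty sets: a vertex and its neighbour lie on opposite
  -- sides, so they differ, while there is only one set of size 0.
  nonempty : (x : V GC) → ∣ vec x ∣ ≢ 0
  nonempty x empty =
    Boolₚ.not-¬ {side x} refl
      (trans (cong side (vertex-≡ {x} {y} both-⊥)) (opposite-sides bir (proj₂ (neighbour x))))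
    where
    y : V GC
    y = proj₁ (neighbour x)
    both-⊥ : vec x ≡ vec y
    both-⊥ = trans (size-zero (vec x) empty)
                   (sym (size-zero (vec y) (trans (size y) (trans (sym (size x)) empty))))

  step-to : (b : Bool) (x : V GC) → side x ≡ b → (Y : Subset N) →
            ∣ Y ∣ ≡ ℓ (not b) → T (empty? (offS x ∩ Y)) →
            Σ (V GC) λ y → side y ≡ not b × offS y ≡ Y
  step-to b x sx Y size-Y disjoint = (w , closed (proj₁ x) w (proj₂ x) edge) ,
    trans (opposite-sides bir edge) (cong not sx) , restrict∁-glue S (part (not b)) Y
    where
    closed : (u w : V G) → T (C u) → T (E G u w) → T (C w)
    closed = proj₂ (proj₂ component)
    v : Subset (ground (suc n'))
    v = glue S (part (not b)) Y
    w : OddVertex (suc n')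
    w = v , trans (∣glue∣ S (part (not b)) Y) (trans (cong (∣ part (not b) ∣ +_) size-Y) (part-size (not b)))
    complementary : restrict S v ≡ ∁ (onS x)
    complementary = begin
        restrict S v         ≡⟨ restrict-glue S (part (not b)) Y ⟩
        part (not b)         ≡⟨ sym (∁-part b) ⟩
        ∁ (part b)           ≡⟨ cong ∁ (trans (cong part (sym sx)) (sym (onS-by-side x))) ⟩
        ∁ (onS x)            ∎
      where open ≡-Reasoning
    edge : T (E G (proj₁ x) w)
    edge = adjacent-off-S (suc n') S (proj₁ x) w (nonempty x) complementary
      (subst (λ Y′ → T (empty? (offS x ∩ Y′))) (sym (restrict∁-glue S (part (not b)) Y)) disjoint)

  complement-level : ∀ b → N ∸ suc (ℓ b) ≡ ℓ (not b)
  complement-level b = trans (cong (_∸ suc (ℓ b)) (sym levels-sum)) (other b)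
    where
    other : ∀ b → suc (k + k') ∸ suc (ℓ b) ≡ ℓ (not b)
    other true = m+n∸m≡n k k'
    other false = m+n∸n≡m k k'

  -- An exchange X → Z of traces off S is realised by two steps, through the
  -- vertex of the other side whose trace off S is ∁ (X ∪ Z).
  exchange-step : (b : Bool) (x : V GC) → side x ≡ b → (Z : Subset N) →
                  ∣ Z ∣ ≡ ℓ b → ∣ offS x ∪ Z ∣ ≡ suc (ℓ b) →
                  Σ (V GC) λ z → side z ≡ b × offS z ≡ Z
  exchange-step b x sx Z size-Z size-∪ =
    proj₁ second , trans (proj₁ (proj₂ second)) (not-involutive b) , proj₂ (proj₂ second)
    where
    Y : Subset N
    Y = ∁ (offS x ∪ Z)
    first : Σ (V GC) λ y → side y ≡ not b × offS y ≡ Y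
    first = step-to b x sx Y
      (trans (∣∁p∣≡n∸∣p∣ (offS x ∪ Z)) (trans (cong (N ∸_) size-∪) (complement-level b)))
      (disjoint-∁-∪ˡ (offS x) Z)
    second : Σ (V GC) λ z → side z ≡ not (not b) × offS z ≡ Z
    second = step-to (not b) (proj₁ first) (proj₁ (proj₂ first)) Z
      (trans size-Z (cong ℓ (sym (not-involutive b))))
      (subst (λ Y′ → T (empty? (Y′ ∩ Z))) (sym (proj₂ (proj₂ first))) (disjoint-∁-∪ʳ (offS x) Z))

  lift : (b : Bool) {X W : Subset N} (x : V GC) → side x ≡ b → offS x ≡ X →
         Chain (ℓ b) X W → Σ (V GC) λ z → side z ≡ b × offS z ≡ W
  lift b x sx ox stay = x , sx , ox
  lift b x sx ox (exchange {Z = Z} size-Z size-∪ c) =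
    lift b (proj₁ next) (proj₁ (proj₂ next)) (proj₂ (proj₂ next)) c
    where
    next : Σ (V GC) λ z → side z ≡ b × offS z ≡ Z
    next = exchange-step b x sx Z size-Z (subst (λ X → ∣ X ∪ Z ∣ ≡ suc (ℓ b)) (sym ox) size-∪)

  -- Every vertex of K(N; k, k') is the image of a vertex of the component:
  -- connect the reference vertex of its side to it by an exchange chain.
  realise : (v : KneserVertex N k k') → Σ (V GC) λ x → toKneser x ≡ v
  realise (b , W , size-W) =
    proj₁ lifted , KneserVertex-≡ (proj₁ (proj₂ lifted)) (proj₂ (proj₂ lifted))
    where
    r : V GC
    r = proj₁ (reference b)
    sr : side r ≡ b
    sr = proj₂ (reference b)
    lifted : Σ (V GC) λ z → side z ≡ b × offS z ≡ W
    lifted = lift b r sr refl (connect (offS r) W (trans (offS-size r) (cong ℓ sr)) size-W)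

  component≅Kneser′ : GC ≅ Kneser N k k'
  component≅Kneser′ = mk↔ₛ′ toKneser (proj₁ ∘ realise) (proj₂ ∘ realise) back-to ,
                      toKneser-edges
    where
    back-to : ∀ x → proj₁ (realise (toKneser x)) ≡ x
    back-to x = determined (cong proj₁ eq) (cong (proj₁ ∘ proj₂) eq)
      where
      eq : toKneser (proj₁ (realise (toKneser x))) ≡ toKneser x
      eq = proj₂ (realise (toKneser x))

  degree-on : (x : V GC) {d : ℕ} → HasDegree GC x d → d ≡ suc (ℓ (not (side x)))
  degree-on x deg = ↔⇒≡ (↔-trans deg (↔-trans (≅-nbhd {GC} {Kneser N k k'} component≅Kneser′ x)
                                              (kneser-degree levels-sum (toKneser x))))

  degree-on-side : (b : Bool) {d : ℕ} → ((x : V GC) → side x ≡ b → HasDegree GC x d) →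
                   d ≡ suc (ℓ (not b))
  degree-on-side b deg = trans (degree-on r (deg r sr)) (cong (λ c → suc (ℓ (not c))) sr)
    where
    r : V GC
    r = proj₁ (reference b)
    sr : side r ≡ b
    sr = proj₂ (reference b)

  s'≡k' : s' ≡ k'
  s'≡k' = suc-injective (degree-on-side true degree-true)

  t'≡k : t' ≡ k
  t'≡k = suc-injective (degree-on-side false degree-false)

  component≅Kneser : GC ≅ Kneser (suc (t' + s')) t' s'
  component≅Kneser =
    ≅-Kneser-cong (trans (sym levels-sum) (cong₂ (λ a b → suc (a + b)) (sym t'≡k) (sym s'≡k')))
                  (sym t'≡k) (sym s'≡k') component≅Kneser′

biregular-component≅Kneser : ∀ n' (S : Subset (ground (suc n')))
  (C : V (OddGraph (suc n') S) → Bool) {s' t'} → IsComponent (OddGraph (suc n') S) C →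
  Biregular (suc s') (suc t') (Induced (OddGraph (suc n') S) C) →
  Induced (OddGraph (suc n') S) C ≅ Kneser (suc (t' + s')) t' s'
biregular-component≅Kneser n' S C component bir =
  BiregularComponent.component≅Kneser n' S C component bir

-- Components with a degree 0 are single vertices; otherwise both components
-- are isomorphic to the same bipartite Kneser graph.
mainTheorem5 : (n m : ℕ) → 1 ≤ n → 1 ≤ m →
    (S : Subset (ground n)) (S' : Subset (ground m)) →
    ∣ S ∣ < ground n → ∣ S' ∣ < ground m →
    (s t : ℕ) →
    (C₁ : V (OddGraph n S) → Bool) (C₂ : V (OddGraph m S') → Bool) →
    IsComponent (OddGraph n S) C₁ → IsComponent (OddGraph m S') C₂ →
    Biregular s t (Induced (OddGraph n S) C₁) →
    Biregular s t (Induced (OddGraph m S') C₂) →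
    Induced (OddGraph n S) C₁ ≅ Induced (OddGraph m S') C₂
mainTheorem5 (suc n') (suc m') _ _ S S' _ _ zero t C₁ C₂ comp₁ comp₂ bir₁ bir₂ =
  trivial-components-≅ comp₁ comp₂ bir₁ bir₂
mainTheorem5 (suc n') (suc m') _ _ S S' _ _ (suc s') zero C₁ C₂ comp₁ comp₂ bir₁ bir₂ =
  trivial-components-≅ comp₁ comp₂ (biregular-swap bir₁) (biregular-swap bir₂)
mainTheorem5 (suc n') (suc m') _ _ S S' _ _ (suc s') (suc t') C₁ C₂ comp₁ comp₂ bir₁ bir₂ =
  ≅-trans {Induced (OddGraph (suc n') S) C₁} {Kneser (suc (t' + s')) t' s'}
          {Induced (OddGraph (suc m') S') C₂} (biregular-component≅Kneser n' S C₁ comp₁ bir₁)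
    (≅-sym {Induced (OddGraph (suc m') S') C₂} {Kneser (suc (t' + s')) t' s'} (biregular-component≅Kneser m' S' C₂ comp₂ bir₂))
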